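{- Let $a,b\in\mathbb{N}$ and let $n,k$ be positive integers with $k>2$. If the two-letter word $ab$ is a factor of $W^{(k)}_n$, then either $k$ divides $b$ or $a<b$.
   Context: The alphabet is $\mathbb{N}=\{0,1,2,\dots\}$. For an integer $k\ge 3$, $\varphi_k$ is the morphism of $\mathbb{N}^*$ defined on letters, for $i\ge 0$ and $0\le j\le k-1$, by $\varphi_k(ki+j)=(ki)(ki+j+1)$ (two letters) if $0\le j\le k-2$, and $\varphi_k(ki+k-1)=(ki+k)$ (one letter). For $n\ge 0$, $W^{(k)}_n=\varphi_k^n(0)$. A factor of a word is a contiguous nonempty subword. -}

module Defs where

open import Data.Nat using (ℕ; zero; suc; _+_; _*_; _<_; _<?_; NonZero)
open import Data.Nat.DivMod using (_/_; _%_)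
open import Data.List using (List; []; _∷_; _++_; concatMap)
open import Data.Product using (∃₂; _×_)
open import Relation.Nullary using (yes; no)
open import Relation.Binary.PropositionalEquality using (_≡_)

-- φ_k on a single letter m = k*i + j (i = m / k, j = m % k):
--   if j ≤ k-2 (i.e. j+1 < k):  φ_k(m) = (k*i) (m+1)
--   if j = k-1:                 φ_k(m) = (k*i + k) = (m+1)
φ-letter : (k : ℕ) → .{{_ : NonZero k}} → ℕ → List ℕ
φ-letter k m with suc (m % k) <? k
... | yes _ = (k * (m / k)) ∷ suc m ∷ []
... | no  _ = suc m ∷ []

φ : (k : ℕ) → .{{_ : NonZero k}} → List ℕ → List ℕ
φ k w = concatMap (φ-letter k) w

W : (k : ℕ) → .{{_ : NonZero k}} → ℕ → List ℕ
W k zero    = 0 ∷ []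
W k (suc n) = φ k (W k n)

IsFactor2 : ℕ → ℕ → List ℕ → Set
IsFactor2 a b w = ∃₂ λ u v → w ≡ u ++ (a ∷ b ∷ v)

module Submission where

open import Defs
open import Data.Nat using (ℕ; suc; _<_; _≤_; _*_; _+_; _<?_; NonZero; s≤s)
open import Data.Nat.Divisibility using (_∣_; divides; m∣m*n)
open import Data.Nat.DivMod using (_/_; _%_; m%n<n; m≡m%n+[m/n]*n; m/n*n≤m)
open import Data.Nat.Properties using (≤-antisym; ≤-pred; ≰⇒>; *-comm)
open import Data.Sum using (_⊎_; inj₁; inj₂)
open import Data.Product using (_,_)
open import Data.Maybe using (just; nothing)
open import Data.Maybe.Relation.Binary.Connected using (Connected; just; just-nothing; nothing-just; nothing)
open import Data.Maybe.Relation.Unary.All as Maybe using (just; nothing)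
open import Data.List using (List; []; _∷_; _++_; concatMap; head; last)
open import Data.List.Relation.Unary.Linked using (Linked; []; [-]; _∷_; tail)
import Data.List.Relation.Unary.Linked as Linked
open import Data.List.Relation.Unary.Linked.Properties using (++⁺)
open import Relation.Binary.PropositionalEquality using (_≡_; cong; subst; module ≡-Reasoning)
open import Relation.Nullary using (yes; no)

-- Each block φ_k(c) starts with a multiple of k and increases inside, so every
-- adjacent pair of φ_k(w) either lies inside one block (a < b) or straddles two
-- blocks (k ∣ b).

module _ {a r} {A : Set a} {R : A → A → Set r} where

  ++⁻ʳ : ∀ xs {ys} → Linked R (xs ++ ys) → Linked R ys
  ++⁻ʳ []       l = l
  ++⁻ʳ (x ∷ xs) l = ++⁻ʳ xs (tail l)

  infix-pair : ∀ u {x y v} → Linked R (u ++ x ∷ y ∷ v) → R x y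
  infix-pair u l = Linked.head (++⁻ʳ u l)

  connected-nothing : ∀ my → Connected R nothing my
  connected-nothing nothing  = nothing
  connected-nothing (just _) = nothing-just

  module _ {q} {Q : A → Set q} (Q⇒R : ∀ {x y} → Q y → R x y) where

    connected-just : ∀ x {my} → Maybe.All Q my → Connected R (just x) my
    connected-just x (just qy) = just (Q⇒R qy)
    connected-just x nothing   = just-nothing

    module _ {b} {B : Set b} (f : B → List A)
             (f-linked : ∀ c → Linked R (f c))
             (f-head : ∀ c → Maybe.All Q (head (f c))) where

      concatMap-head : ∀ w → Maybe.All Q (head (concatMap f w))
      concatMap-head []      = nothing
      concatMap-head (c ∷ w) with f c | f-head c
      ... | []    | _      = concatMap-head w
      ... | _ ∷ _ | just q = just q

      concatMap⁺ : ∀ w → Linked R (concatMap f w)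
      concatMap⁺ []      = []
      concatMap⁺ (c ∷ w) = ++⁺ (f-linked c) (connect (last (f c))) (concatMap⁺ w)
        where
        connect : ∀ mx → Connected R mx (head (concatMap f w))
        connect nothing  = connected-nothing _
        connect (just x) = connected-just x (concatMap-head w)

module _ (k : ℕ) .{{_ : NonZero k}} where

  Step : ℕ → ℕ → Set
  Step x y = (k ∣ y) ⊎ (x < y)

  1+m%k≡k⇒k∣1+m : ∀ m → suc (m % k) ≡ k → k ∣ suc m
  1+m%k≡k⇒k∣1+m m eq = divides (suc (m / k)) (begin
    suc m                   ≡⟨ cong suc (m≡m%n+[m/n]*n m k) ⟩
    suc (m % k) + m / k * k ≡⟨ cong (_+ m / k * k) eq ⟩
    k + m / k * k           ∎)
    where open ≡-Reasoning

  φ-letter-linked : ∀ c → Linked Step (φ-letter k c)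
  φ-letter-linked c with suc (c % k) <? k
  ... | yes _ = inj₂ (s≤s (subst (_≤ c) (*-comm (c / k) k) (m/n*n≤m c k))) ∷ [-]
  ... | no  _ = [-]

  φ-letter-head : ∀ c → Maybe.All (k ∣_) (head (φ-letter k c))
  φ-letter-head c with suc (c % k) <? k
  ... | yes _  = just (m∣m*n (c / k))
  ... | no  ≮k = just (1+m%k≡k⇒k∣1+m c (≤-antisym (m%n<n c k) (≤-pred (≰⇒> ≮k))))

  φ-linked : ∀ w → Linked Step (φ k w)
  φ-linked = concatMap⁺ {Q = k ∣_} inj₁ (φ-letter k) φ-letter-linked φ-letter-head

lemma4p7 : (a b n k : ℕ) → .{{_ : NonZero k}} → 0 < n → 2 < k →
    IsFactor2 a b (W k n) → (k ∣ b) ⊎ (a < b)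
lemma4p7 a b (suc n) k _ _ (u , v , W≡u++ab∷v) =
  infix-pair u (subst (Linked (Step k)) W≡u++ab∷v (φ-linked k (W k n)))
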